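{- Let $P\rhd C\vdash t:T$ be a derivation with support $A$, and let $t'\in\Lambda^{001}$ be such that for every $a\in A$, $\overline a\in\mathrm{supp}(t')$ and $t(\overline a)=t'(\overline a)$. Let $P'$ be the labelled tree with $\mathrm{supp}(P')=A$ whose judgment at each $a\in A$ is $C(a)\vdash t'|_{\overline a}:T(a)$. Then $P'$ is a derivation.
   Context: Sequences: $\mathbb{N}^*$ finite sequences of naturals, $\varepsilon$ empty, $\cdot$ concatenation; the collapse $\overline a$ replaces each entry $\ge2$ of $a$ by $2$. Terms: $\Lambda^{111}$ = possibly infinite $\lambda$-terms $t,u::=x\mid\lambda x.t\mid tu$ (coinductive, up to $\alpha$-equivalence), identified with parsing trees: $\mathrm{supp}(x)=\{\varepsilon\}$ labelled $x$, $\mathrm{supp}(\lambda x.t)=\{\varepsilon\}\cup0\cdot\mathrm{supp}(t)$ labelled $\lambda x$ at $\varepsilon$, $\mathrm{supp}(tu)=\{\varepsilon\}\cup1\cdot\mathrm{supp}(t)\cup2\cdot\mathrm{supp}(u)$ labelled $@$ at $\varepsilon$; $t(p)$ label and $t|_p$ subterm at $p$. $\Lambda^{001}$: terms every infinite branch of whose support has infinitely many entries $2$. Types: mutually coinductive $T::=\alpha\mid F\to T$, $F::=(T_k)_{k\in K}$, $K\subseteq\mathbb{N}\setminus\{0,1\}$, syntactic equality; supports $\mathrm{supp}(\alpha)=\{\varepsilon\}$, $\mathrm{supp}(F\to T)=\{\varepsilon\}\cup\mathrm{supp}(F)\cup1\cdot\mathrm{supp}(T)$, $\mathrm{supp}((T_k)_k)=\bigcup_kk\cdot\mathrm{supp}(T_k)$,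 no infinite branch ending in $1^\omega$. $()$ empty sequence type; $k\cdot T$ single component $T$ at index $k$; disjoint sequence types (disjoint index sets) have a join collecting all components. Contexts map variables to sequence types; $C-x$ resets $x$ to $()$; joins pointwise. Derivations: possibly infinite trees of judgments $C\vdash t:T$ ($t\in\Lambda^{001}$) generated coinductively by (ax) $x:k\cdot T\vdash x:T$, $k\ge2$; (abs) from $C\vdash t:T$ infer $C-x\vdash\lambda x.t:C(x)\to T$; (app) from $C\vdash t:(S_k)_{k\in K}\to T$ and for each $k\in K$ a premise $D_k\vdash u:S_k$, infer $C\cup\bigcup_kD_k\vdash tu:T$, with $C$ and the $D_k$ pairwise disjoint. Support: $\{\varepsilon\}$ for an axiom, $\{\varepsilon\}\cup0\cdot\mathrm{supp}(P_0)$ for (abs), $\{\varepsilon\}\cup1\cdot\mathrm{supp}(P_1)\cup\bigcup_kk\cdot\mathrm{supp}(P_k)$ for (app); the judgment at position $a$ is $C(a)\vdash t|_{\overline a}:T(a)$. -}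

module Defs where

open import Data.Nat using (ℕ; zero; suc; _≤_; _<_)
open import Data.List using (List; []; _∷_; _++_; _∷ʳ_; map)
open import Data.Maybe using (Maybe; just; nothing)
open import Data.Product using (Σ; ∃; _×_; _,_)
open import Data.Sum using (_⊎_)
open import Data.Empty using (⊥)
open import Relation.Nullary using (¬_)
open import Relation.Binary.PropositionalEquality using (_≡_; _≢_)

Pos : Set
Pos = List ℕ

collapseN : ℕ → ℕ
collapseN zero = zero
collapseN (suc zero) = suc zero
collapseN (suc (suc _)) = 2

collapse : Pos → Pos
collapse = map collapseN

prefix : (ℕ → ℕ) → ℕ → Pos
prefix f zero = []
prefix f (suc n) = prefix f n ∷ʳ f n

Tree : Set → Set
Tree L = Pos → Maybe L

Present : {L : Set} → Tree L → Pos → Set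
Present t p = ∃ λ l → t p ≡ just l

IsEmpty : {L : Set} → Tree L → Set
IsEmpty t = ∀ p → t p ≡ nothing

sub : {L : Set} → Tree L → Pos → Tree L
sub t p q = t (p ++ q)

_≈_ : {L : Set} → Tree L → Tree L → Set
t ≈ u = ∀ p → t p ≡ u p

PrefixClosed : {L : Set} → Tree L → Set
PrefixClosed t = ∀ p k → t p ≡ nothing → t (p ∷ʳ k) ≡ nothing

Branch : {L : Set} → Tree L → (ℕ → ℕ) → Set
Branch t f = ∀ n → Present t (prefix f n)

-- Terms Λ^111 (variables are natural numbers), as parsing trees

data TLabel : Set where
  var : ℕ → TLabel
  lam : ℕ → TLabel
  app : TLabel

RawTerm : Set
RawTerm = Tree TLabel

TChildren : TLabel → ℕ → Set
TChildren (var x) k = ⊥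
TChildren (lam x) k = k ≡ 0
TChildren app k = k ≡ 1 ⊎ k ≡ 2

IsTerm : RawTerm → Set
IsTerm t =
  Present t [] ×
  PrefixClosed t ×
  (∀ p l → t p ≡ just l → ∀ k →
     (TChildren l k → Present t (p ∷ʳ k)) ×
     (Present t (p ∷ʳ k) → TChildren l k))

Λ001 : RawTerm → Set
Λ001 t = IsTerm t ×
  (∀ f → Branch t f → ∀ n → ∃ λ m → n ≤ m × f m ≡ 2)

data YLabel : Set where
  atom : ℕ → YLabel
  arr  : YLabel

RawTy : Set
RawTy = Tree YLabel

IsType : RawTy → Set
IsType T =
  Present T [] ×
  PrefixClosed T ×
  (∀ p α → T p ≡ just (atom α) → ∀ k → T (p ∷ʳ k) ≡ nothing) ×
  (∀ p → T p ≡ just arr → Present T (p ∷ʳ 1) × T (p ∷ʳ 0) ≡ nothing) ×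
  (∀ f → Branch T f → ¬ (∃ λ n → ∀ m → n ≤ m → f m ≡ 1))

-- sequence types F = (T_k)_{k ∈ K}: component k is the empty tree if k ∉ K
SeqTy : Set
SeqTy = ℕ → RawTy

IsSeqTy : SeqTy → Set
IsSeqTy F = ∀ k → (k < 2 → IsEmpty (F k)) × (2 ≤ k → IsEmpty (F k) ⊎ IsType (F k))

InIdx : SeqTy → ℕ → Set
InIdx F k = Present (F k) []

_≈ˢ_ : SeqTy → SeqTy → Set
F ≈ˢ G = ∀ k → F k ≈ G k

Ctx : Set
Ctx = ℕ → SeqTy

record Judgment : Set where
  constructor _⊢_∶_
  field
    ctx  : Ctx
    term : RawTerm
    ty   : RawTy
open Judgment public

WFJudgment : Judgment → Set
WFJudgment (C ⊢ t ∶ T) = (∀ x → IsSeqTy (C x)) × Λ001 t × IsType T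

-- Derivations: labelled trees (support A, judgment J a at a ∈ A)
-- which are coinductively generated by (ax), (abs), (app), i.e. every
-- node is a correct instance of one of the rules.

module _ (A : Pos → Set) (J : Pos → Judgment) where

  AxNode : Pos → Set
  AxNode a =
    (∀ k → ¬ A (a ∷ʳ k)) ×
    ∃ λ x → ∃ λ k → 2 ≤ k ×
      term (J a) [] ≡ just (var x) ×
      ctx (J a) x k ≈ ty (J a) ×
      (∀ j → j ≢ k → IsEmpty (ctx (J a) x j)) ×
      (∀ y → y ≢ x → ∀ j → IsEmpty (ctx (J a) y j))

  AbsNode : Pos → Set
  AbsNode a =
    A (a ∷ʳ 0) × (∀ k → k ≢ 0 → ¬ A (a ∷ʳ k)) ×
    ∃ λ x →
      term (J a) [] ≡ just (lam x) ×
      sub (term (J a)) (0 ∷ []) ≈ term (J (a ∷ʳ 0)) ×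
      (∀ j → IsEmpty (ctx (J a) x j)) ×
      (∀ y → y ≢ x → ctx (J a) y ≈ˢ ctx (J (a ∷ʳ 0)) y) ×
      ty (J a) [] ≡ just arr ×
      sub (ty (J a)) (1 ∷ []) ≈ ty (J (a ∷ʳ 0)) ×
      (∀ k → 2 ≤ k → sub (ty (J a)) (k ∷ []) ≈ ctx (J (a ∷ʳ 0)) x k)

  AppNode : Pos → Set
  AppNode a =
    A (a ∷ʳ 1) × ¬ A (a ∷ʳ 0) ×
    let T₁ = ty (J (a ∷ʳ 1))
        C₁ = ctx (J (a ∷ʳ 1))
        K : ℕ → Set
        K k = 2 ≤ k × Present T₁ (k ∷ [])
        D : ℕ → Ctx
        D k = ctx (J (a ∷ʳ k))
    in
    T₁ [] ≡ just arr ×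
    sub T₁ (1 ∷ []) ≈ ty (J a) ×
    term (J a) [] ≡ just app ×
    sub (term (J a)) (1 ∷ []) ≈ term (J (a ∷ʳ 1)) ×
    (∀ k → 2 ≤ k → (A (a ∷ʳ k) → K k) × (K k → A (a ∷ʳ k))) ×
    (∀ k → K k →
       ty (J (a ∷ʳ k)) ≈ sub T₁ (k ∷ []) ×
       term (J (a ∷ʳ k)) ≈ sub (term (J a)) (2 ∷ [])) ×
    (∀ x j k → K k → ¬ (InIdx (C₁ x) j × InIdx (D k x) j)) ×
    (∀ x j k k' → K k → K k' → k ≢ k' → ¬ (InIdx (D k x) j × InIdx (D k' x) j)) ×
    (∀ x j → InIdx (C₁ x) j → ctx (J a) x j ≈ C₁ x j) ×
    (∀ x j k → K k → InIdx (D k x) j → ctx (J a) x j ≈ D k x j) ×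
    (∀ x j → ¬ InIdx (C₁ x) j → (∀ k → K k → ¬ InIdx (D k x) j) →
       IsEmpty (ctx (J a) x j))

  IsDerivation : Set
  IsDerivation =
    A [] ×
    (∀ a k → A (a ∷ʳ k) → A a) ×
    (∀ a → A a → WFJudgment (J a) × (AxNode a ⊎ AbsNode a ⊎ AppNode a))

-- The rules of a derivation look at its terms only through root labels and
-- through the fact that a premise at index k carries the immediate subterm, at
-- the collapsed index k̄, of the conclusion's term.  Hence, by induction on a,
-- the term at position a is t|_ā, and replacing it by t'|_ā preserves both
-- kinds of data: the roots agree by hypothesis, and the subterm relation holds
-- for any t'.  It remains that Λ^001 is closed under subterms: prepending p to
-- an infinite branch of t'|_p gives an infinite branch of t'.
module Submission where

open import Defs
open import Data.List using (List; []; _∷_; _++_; _∷ʳ_; [_]; length)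
open import Data.List.Properties using (++-assoc; ++-identityʳ; map-++)
open import Data.List.Reverse using (Reverse; []; _∶_∶ʳ_; reverseView)
open import Data.Nat using (ℕ; zero; suc; _+_; _≤_; z≤n; s≤s)
open import Data.Nat.Properties using (+-assoc; +-comm; +-suc; +-identityʳ; m≤m+n; m≤n⇒∃[o]m+o≡n)
open import Data.Product using (_×_; _,_; proj₁; proj₂; ∃)
open import Data.Sum using (_⊎_; inj₁; inj₂)
open import Data.Maybe using (just; nothing)
open import Data.Empty using (⊥-elim)
open import Relation.Nullary using (contradiction)
open import Relation.Binary.PropositionalEquality using (_≡_; refl; sym; trans; cong; subst; module ≡-Reasoning)
open ≡-Reasoning

sub-∷ʳ-collapse : {L : Set} (t : Tree L) (a : Pos) (k : ℕ) →
  sub (sub t (collapse a)) (collapseN k ∷ []) ≈ sub t (collapse (a ∷ʳ k))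
sub-∷ʳ-collapse t a k q = cong t (begin
  collapse a ++ collapseN k ∷ q         ≡⟨ ++-assoc (collapse a) [ collapseN k ] q ⟨
  (collapse a ++ [ collapseN k ]) ++ q  ≡⟨ cong (_++ q) (map-++ collapseN a [ k ]) ⟨
  collapse (a ∷ʳ k) ++ q                ∎)

Present-∷ʳ : {L : Set} {t : Tree L} → PrefixClosed t →
  ∀ p k → Present t (p ∷ʳ k) → Present t p
Present-∷ʳ {t = t} closed p k (_ , tpk) with t p in tp
... | just l = l , refl
... | nothing = contradiction (trans (sym (closed p k tp)) tpk) λ ()

Present-++ : {L : Set} {t : Tree L} → PrefixClosed t →
  ∀ p q → Present t (p ++ q) → Present t p
Present-++ {t = t} closed p [] pq = subst (Present t) (++-identityʳ p) pq
Present-++ {t = t} closed p (k ∷ q) pq =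
  Present-∷ʳ closed p k (Present-++ closed (p ∷ʳ k) q
    (subst (Present t) (sym (++-assoc p [ k ] q)) pq))

sub-∷ʳ : {L : Set} (t : Tree L) (p q : Pos) (k : ℕ) →
  sub t p (q ∷ʳ k) ≡ t ((p ++ q) ∷ʳ k)
sub-∷ʳ t p q k = cong t (sym (++-assoc p q [ k ]))

IsTerm-sub : ∀ {t} p → IsTerm t → Present t p → IsTerm (sub t p)
IsTerm-sub {t} p (_ , closed , children) tp =
  subst (Present t) (sym (++-identityʳ p)) tp ,
  (λ q k tq → trans (sub-∷ʳ t p q k) (closed (p ++ q) k tq)) ,
  λ q l tq k →
    (λ c → subst (Present t) (++-assoc p q [ k ]) (proj₁ (children (p ++ q) l tq k) c)) ,
    (λ pk → proj₂ (children (p ++ q) l tq k) (subst (Present t) (sym (++-assoc p q [ k ])) pk))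

infixr 5 _++ˢ_

_++ˢ_ : List ℕ → (ℕ → ℕ) → ℕ → ℕ
([] ++ˢ f) n = f n
((x ∷ p) ++ˢ f) zero = x
((x ∷ p) ++ˢ f) (suc n) = (p ++ˢ f) n

++ˢ-length : ∀ p f n → (p ++ˢ f) (length p + n) ≡ f n
++ˢ-length [] f n = refl
++ˢ-length (x ∷ p) f n = ++ˢ-length p f n

prefix-suc : ∀ g n → prefix g (suc n) ≡ g 0 ∷ prefix (λ m → g (suc m)) n
prefix-suc g zero = refl
prefix-suc g (suc n) = cong (_∷ʳ g (suc n)) (prefix-suc g n)

prefix-++ˢ : ∀ p f n → prefix (p ++ˢ f) (length p + n) ≡ p ++ prefix f n
prefix-++ˢ [] f n = refl
prefix-++ˢ (x ∷ p) f n =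
  trans (prefix-suc ((x ∷ p) ++ˢ f) (length p + n)) (cong (x ∷_) (prefix-++ˢ p f n))

prefix-+ : ∀ g m n → prefix g (m + n) ≡ prefix g m ++ prefix (λ i → g (m + i)) n
prefix-+ g m zero rewrite +-identityʳ m = sym (++-identityʳ (prefix g m))
prefix-+ g m (suc n) rewrite +-suc m n =
  trans (cong (_∷ʳ g (m + n)) (prefix-+ g m n))
        (++-assoc (prefix g m) (prefix (λ i → g (m + i)) n) [ g (m + n) ])

Branch-++ˢ : {L : Set} {t : Tree L} → PrefixClosed t →
  ∀ p f → Branch (sub t p) f → Branch t (p ++ˢ f)
Branch-++ˢ {t = t} closed p f branch m =
  Present-++ closed (prefix g m) _ (subst (Present t) p++f≡g (branch m))
  where
  g : ℕ → ℕ
  g = p ++ˢ f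
  p++f≡g : p ++ prefix f m ≡ prefix g m ++ prefix (λ i → g (m + i)) (length p)
  p++f≡g = begin
    p ++ prefix f m          ≡⟨ prefix-++ˢ p f m ⟨
    prefix g (length p + m)  ≡⟨ cong (prefix g) (+-comm (length p) m) ⟩
    prefix g (m + length p)  ≡⟨ prefix-+ g m (length p) ⟩
    prefix g m ++ prefix (λ i → g (m + i)) (length p) ∎

InfinitelyOften : (ℕ → ℕ) → ℕ → Set
InfinitelyOften f c = ∀ n → ∃ λ m → n ≤ m × f m ≡ c

InfinitelyOften-++ˢ : ∀ p f c → InfinitelyOften (p ++ˢ f) c → InfinitelyOften f c
InfinitelyOften-++ˢ p f c often n
  with m , p+n≤m , pf≡c ← often (length p + n)
  with o , refl ← m≤n⇒∃[o]m+o≡n p+n≤m =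
  n + o , m≤m+n n o , (begin
    f (n + o)                      ≡⟨ ++ˢ-length p f (n + o) ⟨
    (p ++ˢ f) (length p + (n + o)) ≡⟨ cong (p ++ˢ f) (+-assoc (length p) n o) ⟨
    (p ++ˢ f) (length p + n + o)   ≡⟨ pf≡c ⟩
    c                              ∎)

Λ001-sub : ∀ {t} p → Λ001 t → Present t p → Λ001 (sub t p)
Λ001-sub p (isTerm@(_ , closed , _) , often2) tp =
  IsTerm-sub p isTerm tp ,
  λ f branch → InfinitelyOften-++ˢ p f 2 (often2 (p ++ˢ f) (Branch-++ˢ closed p f branch))

module _ {A : Pos → Set} {J : Pos → Judgment} (derivation : IsDerivation A J) where

  private
    closed = proj₁ (proj₂ derivation)
    nodes = proj₂ (proj₂ derivation)

  child-term : ∀ a k → A (a ∷ʳ k) → term (J (a ∷ʳ k)) ≈ sub (term (J a)) (collapseN k ∷ [])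
  child-term a k Aak with proj₂ (nodes a (closed a k Aak))
  ... | inj₁ (leaf , _) = ⊥-elim (leaf k Aak)
  ... | inj₂ (inj₁ (_ , only0 , _ , _ , body , _)) = abs-child k Aak
    where
    abs-child : ∀ k → A (a ∷ʳ k) → term (J (a ∷ʳ k)) ≈ sub (term (J a)) (collapseN k ∷ [])
    abs-child zero _ q = sym (body q)
    abs-child (suc k) Ak = ⊥-elim (only0 (suc k) (λ ()) Ak)
  ... | inj₂ (inj₂ (_ , ¬A0 , _ , _ , _ , fun , args , arg , _)) = app-child k Aak
    where
    app-child : ∀ k → A (a ∷ʳ k) → term (J (a ∷ʳ k)) ≈ sub (term (J a)) (collapseN k ∷ [])
    app-child 0 A0 = ⊥-elim (¬A0 A0)
    app-child 1 _ q = sym (fun q)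
    app-child (suc (suc k)) Ak = proj₂ (arg _ (proj₁ (args _ (s≤s (s≤s z≤n))) Ak))

  term-collapse : ∀ a → A a → term (J a) ≈ sub (term (J [])) (collapse a)
  term-collapse a = along a (reverseView a)
    where
    along : ∀ a → Reverse a → A a → term (J a) ≈ sub (term (J [])) (collapse a)
    along .[] [] _ q = refl
    along .(a ∷ʳ k) (a ∶ ra ∶ʳ k) Aak q = begin
      term (J (a ∷ʳ k)) q                        ≡⟨ child-term a k Aak q ⟩
      term (J a) (collapseN k ∷ q)               ≡⟨ along a ra (closed a k Aak) (collapseN k ∷ q) ⟩
      term (J []) (collapse a ++ collapseN k ∷ q) ≡⟨ sub-∷ʳ-collapse (term (J [])) a k q ⟩
      term (J []) (collapse (a ∷ʳ k) ++ q)       ∎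

  IsDerivation-reterm : (u : Pos → RawTerm) →
    (∀ a → A a → Λ001 (u a)) →
    (∀ a → A a → u a [] ≡ term (J a) []) →
    (∀ a k → u (a ∷ʳ k) ≈ sub (u a) (collapseN k ∷ [])) →
    IsDerivation A (λ a → ctx (J a) ⊢ u a ∶ ty (J a))
  IsDerivation-reterm u uΛ roots children =
    proj₁ derivation , closed , λ a Aa → node a Aa (nodes a Aa)
    where
    J' : Pos → Judgment
    J' a = ctx (J a) ⊢ u a ∶ ty (J a)

    args-term : ∀ a k → 2 ≤ k → u (a ∷ʳ k) ≈ sub (u a) (2 ∷ [])
    args-term a (suc (suc k)) _ = children a (suc (suc k))
    args-term a 1 (s≤s ())

    node : ∀ a → A a → WFJudgment (J a) × (AxNode A J a ⊎ AbsNode A J a ⊎ AppNode A J a) →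
      WFJudgment (J' a) × (AxNode A J' a ⊎ AbsNode A J' a ⊎ AppNode A J' a)
    node a Aa ((ctxs , _ , type) , inj₁ (leaf , x , k , 2≤k , root , rest)) =
      (ctxs , uΛ a Aa , type) , inj₁ (leaf , x , k , 2≤k , trans (roots a Aa) root , rest)
    node a Aa ((ctxs , _ , type) , inj₂ (inj₁ (A0 , only0 , x , root , _ , rest))) =
      (ctxs , uΛ a Aa , type) ,
      inj₂ (inj₁ (A0 , only0 , x , trans (roots a Aa) root , (λ q → sym (children a 0 q)) , rest))
    node a Aa ((ctxs , _ , type) ,
               inj₂ (inj₂ (A1 , ¬A0 , arrow , result , root , _ , args , arg , rest))) =
      (ctxs , uΛ a Aa , type) ,
      inj₂ (inj₂ (A1 , ¬A0 , arrow , result , trans (roots a Aa) root , (λ q → sym (children a 1 q)) ,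
                  args , (λ k Kk → proj₁ (arg k Kk) , args-term a k (proj₁ Kk)) , rest))

lemma1 : (A : List ℕ → Set) (J : List ℕ → Judgment) (t' : RawTerm) →
    IsDerivation A J →
    Λ001 t' →
    (∀ a → A a →
       Present t' (collapse a) × term (J []) (collapse a) ≡ t' (collapse a)) →
    IsDerivation A (λ a → ctx (J a) ⊢ sub t' (collapse a) ∶ ty (J a))
lemma1 A J t' derivation t'∈Λ agree =
  IsDerivation-reterm derivation (λ a → sub t' (collapse a))
    (λ a Aa → Λ001-sub (collapse a) t'∈Λ (proj₁ (agree a Aa)))
    roots
    (λ a k q → sym (sub-∷ʳ-collapse t' a k q))
  where
  roots : ∀ a → A a → sub t' (collapse a) [] ≡ term (J a) []
  roots a Aa = begin
    t' (collapse a ++ [])           ≡⟨ cong t' (++-identityʳ (collapse a)) ⟩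
    t' (collapse a)                 ≡⟨ proj₂ (agree a Aa) ⟨
    term (J []) (collapse a)        ≡⟨ cong (term (J [])) (++-identityʳ (collapse a)) ⟨
    term (J []) (collapse a ++ [])  ≡⟨ term-collapse derivation a Aa [] ⟨
    term (J a) []                   ∎
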